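{- Neither $\mathcal{L}_{\mathsf{D}}$ nor $\mathcal{L}_{\mathsf{I}}$ has a sound and complete finite axiomatization.
   Context: Fix a countably infinite set $\mathit{PROP}$ of proposition symbols; assignments are maps $w:\mathit{PROP}\to\{0,1\}$; an SD-model is a (possibly empty) set $W$ of assignments. $\mathcal{L}_{\mathsf{D}}$: formulae $\varphi ::= p \mid \neg\varphi \mid (\varphi\to\varphi) \mid \mathsf{D}(\varphi_1,\dots,\varphi_k;\psi)$, $p\in\mathit{PROP}$, $k\in\mathbb{N}$. Semantics at $w\in W$: $W,w\models p$ iff $w(p)=1$; $\neg,\to$ classical; $W,w\models\mathsf{D}(\varphi_1,\dots,\varphi_k;\psi)$ iff for all $u,v\in W$, if $u,v$ agree on the truth (in $W$) of each $\varphi_i$ then they agree on the truth of $\psi$. $\mathcal{L}_{\mathsf{I}}$: formulae $\varphi ::= p\mid\neg\varphi\mid(\varphi\to\varphi)\mid(\varphi_1,\dots,\varphi_k)\,\mathsf{I}_{(\theta_1,\dots,\theta_m)}(\psi_1,\dots,\psi_n)$ with $k,n\ge1$, $m\ge 0$; $W,w\models(\varphi_1,\dots,\varphi_k)\,\mathsf{I}_{(\theta_1,\dots,\theta_m)}(\psi_1,\dots,\psi_n)$ iff for all $w_1,w_2\in W$ agreeing on the truth of each $\theta_i$ there is $v\in W$ agreeing with $w_1$ on each $\theta_i$ and each $\varphi_i$ and with $w_2$ on each $\psi_i$. Other clauses as for $\mathcal{L}_{\mathsf{D}}$. A formula is valid if it is true at every $w$ in every SD-model $W$. An axiom schema for a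 logic $L\in\{\mathcal{L}_{\mathsf{D}},\mathcal{L}_{\mathsf{I}}\}$ is an object obtained from a formula $\chi$ of $L$ by substituting schema letters for all proposition symbols of $\chi$ (its instances are obtained by substituting formulae of $L$ for the schema letters). A proof rule is an implication "$\vdash\psi_1,\dots,\vdash\psi_k\Rightarrow\ \vdash\chi$" where $\psi_1,\dots,\psi_k,\chi$ are axiom schemata and $k$ is a positive integer. A finite axiomatization is a pair $(\Phi,\Psi)$ with $\Phi$ a finite set of axiom schemata and $\Psi$ a finite set of proof rules; its theorems are the formulae derivable from instances of the schemata in $\Phi$ using instances of the rules in $\Psi$. It is sound and complete if its theorems are exactly the valid formulae. -}

module Defs where

open import Data.Nat using (ℕ)
open import Data.Bool using (Bool; true)
open import Data.List using (List; []; _∷_)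
open import Data.List.NonEmpty using (List⁺; _∷_)
open import Data.Product using (Σ; _×_; _,_)
open import Data.Unit using (⊤)
open import Data.Empty using (⊥)
open import Relation.Nullary using (¬_)
open import Relation.Binary.PropositionalEquality using (_≡_)
open import Level using (Level) renaming (suc to lsuc; zero to 0ℓ)

PROP : Set
PROP = ℕ

Assignment : Set
Assignment = PROP → Bool

SDModel : Set₁
SDModel = Assignment → Set

_⇔_ : Set → Set → Set
A ⇔ B = (A → B) × (B → A)

data FormD : Set where
  atom : PROP → FormD
  neg  : FormD → FormD
  imp  : FormD → FormD → FormD
  dep  : List FormD → FormD → FormD

mutual
  substD : (PROP → FormD) → FormD → FormD
  substD σ (atom p)   = σ p
  substD σ (neg φ)    = neg (substD σ φ)
  substD σ (imp φ ψ)  = imp (substD σ φ) (substD σ ψ)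
  substD σ (dep φs ψ) = dep (substDs σ φs) (substD σ ψ)

  substDs : (PROP → FormD) → List FormD → List FormD
  substDs σ []       = []
  substDs σ (φ ∷ φs) = substD σ φ ∷ substDs σ φs

mutual
  satD : SDModel → Assignment → FormD → Set
  satD W w (atom p)   = w p ≡ true
  satD W w (neg φ)    = ¬ satD W w φ
  satD W w (imp φ ψ)  = satD W w φ → satD W w ψ
  satD W w (dep φs ψ) =
    (u v : Assignment) → W u → W v →
    agreeD W u v φs → (satD W u ψ ⇔ satD W v ψ)

  agreeD : SDModel → Assignment → Assignment → List FormD → Set
  agreeD W u v []       = ⊤
  agreeD W u v (φ ∷ φs) = (satD W u φ ⇔ satD W v φ) × agreeD W u v φs

ValidD : FormD → Set₁
ValidD φ = (W : SDModel) (w : Assignment) → W w → satD W w φ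

data FormI : Set where
  atom : PROP → FormI
  neg  : FormI → FormI
  imp  : FormI → FormI → FormI
  -- (φ₁,…,φₖ) I_(θ₁,…,θₘ) (ψ₁,…,ψₙ), k,n ≥ 1, m ≥ 0
  ind  : List⁺ FormI → List FormI → List⁺ FormI → FormI

mutual
  substI : (PROP → FormI) → FormI → FormI
  substI σ (atom p)        = σ p
  substI σ (neg φ)         = neg (substI σ φ)
  substI σ (imp φ ψ)       = imp (substI σ φ) (substI σ ψ)
  substI σ (ind φs θs ψs)  = ind (substI⁺ σ φs) (substIs σ θs) (substI⁺ σ ψs)

  substIs : (PROP → FormI) → List FormI → List FormI
  substIs σ []       = []
  substIs σ (φ ∷ φs) = substI σ φ ∷ substIs σ φs

  substI⁺ : (PROP → FormI) → List⁺ FormI → List⁺ FormI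
  substI⁺ σ (φ ∷ φs) = substI σ φ ∷ substIs σ φs

mutual
  satI : SDModel → Assignment → FormI → Set
  satI W w (atom p)       = w p ≡ true
  satI W w (neg φ)        = ¬ satI W w φ
  satI W w (imp φ ψ)      = satI W w φ → satI W w ψ
  satI W w (ind φs θs ψs) =
    (w₁ w₂ : Assignment) → W w₁ → W w₂ → agreeI W w₁ w₂ θs →
    Σ Assignment λ v → W v × agreeI W v w₁ θs × agreeI⁺ W v w₁ φs × agreeI⁺ W v w₂ ψs

  agreeI : SDModel → Assignment → Assignment → List FormI → Set
  agreeI W u v []       = ⊤
  agreeI W u v (φ ∷ φs) = (satI W u φ ⇔ satI W v φ) × agreeI W u v φs

  agreeI⁺ : SDModel → Assignment → Assignment → List⁺ FormI → Set
  agreeI⁺ W u v (φ ∷ φs) = (satI W u φ ⇔ satI W v φ) × agreeI W u v φs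

ValidI : FormI → Set₁
ValidI φ = (W : SDModel) (w : Assignment) → W w → satI W w φ

-- An axiom schema is a formula whose proposition symbols are read as
-- schema letters; its instances are the images under substitutions
-- σ : PROP → F of formulae for schema letters.

module Axiomatics (F : Set) (subst : (PROP → F) → F → F) where

  Schema : Set
  Schema = F

  record Rule : Set where
    constructor rule
    field
      premises   : List⁺ Schema
      conclusion : Schema

  record Axiomatization : Set where
    constructor axiomatization
    field
      axioms : List Schema
      rules  : List Rule

  open import Data.List.Membership.Propositional using (_∈_)

  module _ (Ax : Axiomatization) where
    open Axiomatization Ax

    mutual
      data Theorem : F → Set where
        ax  : ∀ {χ} → χ ∈ axioms → (σ : PROP → F) → Theorem (subst σ χ)
        app : ∀ {r} → r ∈ rules → (σ : PROP → F) →
              AllTheorems σ (Rule.premises r) →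
              Theorem (subst σ (Rule.conclusion r))

      data AllTheorems (σ : PROP → F) : List⁺ F → Set where
        _∷_ : ∀ {ψ ψs} → Theorem (subst σ ψ) → AllTheoremsL σ ψs →
              AllTheorems σ (ψ ∷ ψs)

      data AllTheoremsL (σ : PROP → F) : List F → Set where
        []  : AllTheoremsL σ []
        _∷_ : ∀ {ψ ψs} → Theorem (subst σ ψ) → AllTheoremsL σ ψs →
              AllTheoremsL σ (ψ ∷ ψs)

  SoundAndComplete : (F → Set₁) → Axiomatization → Set₁
  SoundAndComplete Valid Ax =
    ((φ : F) → Theorem Ax φ → Valid φ) × ((φ : F) → Valid φ → Theorem Ax φ)

  HasSoundCompleteFiniteAxiomatization : (F → Set₁) → Set₁
  HasSoundCompleteFiniteAxiomatization Valid =
    Σ Axiomatization λ Ax → SoundAndComplete Valid Ax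

open Axiomatics FormD substD using ()
  renaming (HasSoundCompleteFiniteAxiomatization to HasFinAxD)
open Axiomatics FormI substI using ()
  renaming (HasSoundCompleteFiniteAxiomatization to HasFinAxI)

LD-FinitelyAxiomatizable : Set₁
LD-FinitelyAxiomatizable = HasFinAxD ValidD

LI-FinitelyAxiomatizable : Set₁
LI-FinitelyAxiomatizable = HasFinAxI ValidI

-- A finite axiomatization only mentions dependence (independence) atoms up to
-- some arity B.  Replacing every atom of arity exactly B + 1 by ⊥ commutes with
-- all substitution instances of its schemata, so the set of its theorems is
-- closed under this translation.  But the atom D(p, …, p; p) with B + 1 copies
-- of p (respectively (p, …, p) I_(p) (p)) is valid while its translation ⊥ is
-- not, so the axiomatization cannot be both sound and complete.
module Submission where

open import Defs
open import Axiom.ExcludedMiddle using (ExcludedMiddle)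
open import Data.Bool using (true; if_then_else_)
open import Data.List using (List; []; _∷_; _++_; concat; map; length; replicate)
open import Data.List.Extrema.Nat using (max; xs≤max)
open import Data.List.NonEmpty as List⁺ using (List⁺; _∷_; toList)
open import Data.List.Properties using (length-map; length-replicate)
open import Data.List.Relation.Unary.All as All using (All; []; _∷_)
open import Data.List.Relation.Unary.All.Properties using (++⁻; concat⁻; map⁻)
open import Data.Nat using (ℕ; suc; _≤_; _⊔_; _≟_; s≤s)
open import Data.Nat.Properties using (m⊔n≤o⇒m≤o; m⊔n≤o⇒n≤o; <⇒≢)
open import Data.Product using (Σ; ∃; _×_; _,_; proj₁; proj₂)
open import Data.Unit using (⊤; tt)
open import Function using (_∘_; id)
open import Relation.Nullary using (¬_; does)
open import Relation.Nullary.Decidable using (dec-true; dec-false)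
open import Relation.Binary.PropositionalEquality
  using (_≡_; _≢_; refl; sym; trans; cong; cong₂; subst; module ≡-Reasoning)

bounded : ∀ {A : Set} (f : A → ℕ) (xs : List A) → ∃ λ B → All (λ x → f x ≤ B) xs
bounded f xs = max 0 (map f xs) , map⁻ (xs≤max 0 (map f xs))

module Schematic (F : Set) (substF : (PROP → F) → F → F) where
  open Axiomatics F substF

  ruleSchemata : Rule → List F
  ruleSchemata (rule ψs χ) = χ ∷ toList ψs

  schemata : Axiomatization → List F
  schemata (axiomatization axioms rules) = axioms ++ concat (map ruleSchemata rules)

  CommutesWithSubst : (F → F) → F → Set
  CommutesWithSubst T χ = ∀ σ → T (substF σ χ) ≡ substF (T ∘ σ) χ

  module _ (T : F → F) (Ax : Axiomatization) where
    open Axiomatization Ax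

    Theorem-map : All (CommutesWithSubst T) (schemata Ax) →
                  ∀ {φ} → Theorem Ax φ → Theorem Ax (T φ)
    Theorem-map commutes = theorem
      where
      axioms-commute : All (CommutesWithSubst T) axioms
      axioms-commute = proj₁ (++⁻ axioms commutes)

      rules-commute : All (All (CommutesWithSubst T) ∘ ruleSchemata) rules
      rules-commute = map⁻ (concat⁻ (proj₂ (++⁻ axioms commutes)))

      instance-of : ∀ {χ} σ → CommutesWithSubst T χ →
                    Theorem Ax (T (substF σ χ)) → Theorem Ax (substF (T ∘ σ) χ)
      instance-of σ c = subst (Theorem Ax) (c σ)

      mutual
        theorem : ∀ {φ} → Theorem Ax φ → Theorem Ax (T φ)
        theorem (ax {χ} m σ) =
          subst (Theorem Ax) (sym (All.lookup axioms-commute m σ)) (ax m (T ∘ σ))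
        theorem (app m σ (t ∷ ts))
          with All.lookup rules-commute m
        ... | c ∷ cψ ∷ cψs =
          subst (Theorem Ax) (sym (c σ))
            (app m (T ∘ σ) (instance-of σ cψ (theorem t) ∷ premises σ cψs ts))

        premises : ∀ σ {ψs} → All (CommutesWithSubst T) ψs →
                   AllTheoremsL Ax σ ψs → AllTheoremsL Ax (T ∘ σ) ψs
        premises σ [] [] = []
        premises σ (cψ ∷ cψs) (t ∷ ts) = instance-of σ cψ (theorem t) ∷ premises σ cψs ts

  ¬finitely-axiomatizable :
    (Valid : F → Set₁) (arity : F → ℕ) (T : ℕ → F → F) →
    (∀ {B χ} → arity χ ≤ B → CommutesWithSubst (T B) χ) →
    (∀ B → Σ F λ φ → Valid φ × ¬ Valid (T B φ)) →
    ¬ HasSoundCompleteFiniteAxiomatization Valid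
  ¬finitely-axiomatizable Valid arity T commutes witness (Ax , sound , complete)
    with bounded arity (schemata Ax)
  ... | B , bound with witness B
  ... | φ , valid , invalid =
    invalid (sound _ (Theorem-map (T B) Ax (All.map commutes bound) (complete φ valid)))

falsumD : FormD
falsumD = neg (imp (atom 0) (atom 0))

¬valid-falsumD : ¬ ValidD falsumD
¬valid-falsumD valid = valid (λ _ → ⊤) (λ _ → true) tt id

mutual
  arityD : FormD → ℕ
  arityD (atom p)   = 0
  arityD (neg φ)    = arityD φ
  arityD (imp φ ψ)  = arityD φ ⊔ arityD ψ
  arityD (dep φs ψ) = length φs ⊔ aritiesD φs ⊔ arityD ψ

  aritiesD : List FormD → ℕ
  aritiesD []       = 0
  aritiesD (φ ∷ φs) = arityD φ ⊔ aritiesD φs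

mutual
  eraseD : ℕ → FormD → FormD
  eraseD n (atom p)   = atom p
  eraseD n (neg φ)    = neg (eraseD n φ)
  eraseD n (imp φ ψ)  = imp (eraseD n φ) (eraseD n ψ)
  eraseD n (dep φs ψ) =
    if does (length φs ≟ n) then falsumD else dep (erasesD n φs) (eraseD n ψ)

  erasesD : ℕ → List FormD → List FormD
  erasesD n []       = []
  erasesD n (φ ∷ φs) = eraseD n φ ∷ erasesD n φs

substDs≡map : ∀ σ φs → substDs σ φs ≡ map (substD σ) φs
substDs≡map σ []       = refl
substDs≡map σ (φ ∷ φs) = cong (substD σ φ ∷_) (substDs≡map σ φs)

length-substDs : ∀ σ φs → length (substDs σ φs) ≡ length φs
length-substDs σ φs = trans (cong length (substDs≡map σ φs)) (length-map (substD σ) φs)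

eraseD-arity : ∀ {n} φs ψ → length φs ≡ n → eraseD n (dep φs ψ) ≡ falsumD
eraseD-arity {n} φs ψ eq rewrite dec-true (length φs ≟ n) eq = refl

eraseD-other-arity : ∀ {n} φs ψ → length φs ≢ n →
                     eraseD n (dep φs ψ) ≡ dep (erasesD n φs) (eraseD n ψ)
eraseD-other-arity {n} φs ψ ne rewrite dec-false (length φs ≟ n) ne = refl

mutual
  eraseD-substD : ∀ {B} σ χ → arityD χ ≤ B →
                  eraseD (suc B) (substD σ χ) ≡ substD (eraseD (suc B) ∘ σ) χ
  eraseD-substD σ (atom p)  h = refl
  eraseD-substD σ (neg χ)   h = cong neg (eraseD-substD σ χ h)
  eraseD-substD σ (imp χ ξ) h =
    cong₂ imp (eraseD-substD σ χ (m⊔n≤o⇒m≤o _ _ h)) (eraseD-substD σ ξ (m⊔n≤o⇒n≤o _ _ h))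
  eraseD-substD {B} σ (dep φs ψ) h = begin
    eraseD (suc B) (dep (substDs σ φs) (substD σ ψ))
      ≡⟨ eraseD-other-arity (substDs σ φs) (substD σ ψ)
           (subst (_≢ suc B) (sym (length-substDs σ φs)) (<⇒≢ (s≤s length≤))) ⟩
    dep (erasesD (suc B) (substDs σ φs)) (eraseD (suc B) (substD σ ψ))
      ≡⟨ cong₂ dep (erasesD-substDs σ φs φs≤) (eraseD-substD σ ψ ψ≤) ⟩
    substD (eraseD (suc B) ∘ σ) (dep φs ψ) ∎
    where
    open ≡-Reasoning
    φs′≤ : length φs ⊔ aritiesD φs ≤ B
    φs′≤ = m⊔n≤o⇒m≤o _ (arityD ψ) h
    length≤ : length φs ≤ B
    length≤ = m⊔n≤o⇒m≤o _ (aritiesD φs) φs′≤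
    φs≤ : aritiesD φs ≤ B
    φs≤ = m⊔n≤o⇒n≤o (length φs) _ φs′≤
    ψ≤ : arityD ψ ≤ B
    ψ≤ = m⊔n≤o⇒n≤o (length φs ⊔ aritiesD φs) _ h

  erasesD-substDs : ∀ {B} σ φs → aritiesD φs ≤ B →
                    erasesD (suc B) (substDs σ φs) ≡ substDs (eraseD (suc B) ∘ σ) φs
  erasesD-substDs σ []       h = refl
  erasesD-substDs σ (φ ∷ φs) h =
    cong₂ _∷_ (eraseD-substD σ φ (m⊔n≤o⇒m≤o _ _ h)) (erasesD-substDs σ φs (m⊔n≤o⇒n≤o _ _ h))

trivialDep : ℕ → FormD
trivialDep n = dep (replicate (suc n) (atom 0)) (atom 0)

valid-trivialDep : ∀ n → ValidD (trivialDep n)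
valid-trivialDep n W w _ u v _ _ (same , _) = same

¬LD-FinitelyAxiomatizable : ¬ LD-FinitelyAxiomatizable
¬LD-FinitelyAxiomatizable =
  Schematic.¬finitely-axiomatizable FormD substD ValidD arityD (eraseD ∘ suc)
    (λ {_} {χ} h σ → eraseD-substD σ χ h)
    (λ B → trivialDep B , valid-trivialDep B ,
      subst (¬_ ∘ ValidD)
        (sym (eraseD-arity (replicate (suc B) (atom 0)) (atom 0) (length-replicate (suc B))))
        ¬valid-falsumD)

falsumI : FormI
falsumI = neg (imp (atom 0) (atom 0))

¬valid-falsumI : ¬ ValidI falsumI
¬valid-falsumI valid = valid (λ _ → ⊤) (λ _ → true) tt id

mutual
  arityI : FormI → ℕ
  arityI (atom p)       = 0
  arityI (neg φ)        = arityI φ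
  arityI (imp φ ψ)      = arityI φ ⊔ arityI ψ
  arityI (ind φs θs ψs) = List⁺.length φs ⊔ arities⁺ φs ⊔ aritiesI θs ⊔ arities⁺ ψs

  aritiesI : List FormI → ℕ
  aritiesI []       = 0
  aritiesI (φ ∷ φs) = arityI φ ⊔ aritiesI φs

  arities⁺ : List⁺ FormI → ℕ
  arities⁺ (φ ∷ φs) = arityI φ ⊔ aritiesI φs

mutual
  eraseI : ℕ → FormI → FormI
  eraseI n (atom p)       = atom p
  eraseI n (neg φ)        = neg (eraseI n φ)
  eraseI n (imp φ ψ)      = imp (eraseI n φ) (eraseI n ψ)
  eraseI n (ind φs θs ψs) =
    if does (List⁺.length φs ≟ n) then falsumI
    else ind (erase⁺ n φs) (erasesI n θs) (erase⁺ n ψs)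

  erasesI : ℕ → List FormI → List FormI
  erasesI n []       = []
  erasesI n (φ ∷ φs) = eraseI n φ ∷ erasesI n φs

  erase⁺ : ℕ → List⁺ FormI → List⁺ FormI
  erase⁺ n (φ ∷ φs) = eraseI n φ ∷ erasesI n φs

substIs≡map : ∀ σ φs → substIs σ φs ≡ map (substI σ) φs
substIs≡map σ []       = refl
substIs≡map σ (φ ∷ φs) = cong (substI σ φ ∷_) (substIs≡map σ φs)

length-substI⁺ : ∀ σ φs → List⁺.length (substI⁺ σ φs) ≡ List⁺.length φs
length-substI⁺ σ (φ ∷ φs) =
  cong suc (trans (cong length (substIs≡map σ φs)) (length-map (substI σ) φs))

eraseI-arity : ∀ {n} φs θs ψs → List⁺.length φs ≡ n → eraseI n (ind φs θs ψs) ≡ falsumI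
eraseI-arity {n} φs θs ψs eq rewrite dec-true (List⁺.length φs ≟ n) eq = refl

eraseI-other-arity : ∀ {n} φs θs ψs → List⁺.length φs ≢ n →
                     eraseI n (ind φs θs ψs) ≡ ind (erase⁺ n φs) (erasesI n θs) (erase⁺ n ψs)
eraseI-other-arity {n} φs θs ψs ne rewrite dec-false (List⁺.length φs ≟ n) ne = refl

mutual
  eraseI-substI : ∀ {B} σ χ → arityI χ ≤ B →
                  eraseI (suc B) (substI σ χ) ≡ substI (eraseI (suc B) ∘ σ) χ
  eraseI-substI σ (atom p)  h = refl
  eraseI-substI σ (neg χ)   h = cong neg (eraseI-substI σ χ h)
  eraseI-substI σ (imp χ ξ) h =
    cong₂ imp (eraseI-substI σ χ (m⊔n≤o⇒m≤o _ _ h)) (eraseI-substI σ ξ (m⊔n≤o⇒n≤o _ _ h))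
  eraseI-substI {B} σ (ind φs θs ψs) h = begin
    eraseI (suc B) (ind (substI⁺ σ φs) (substIs σ θs) (substI⁺ σ ψs))
      ≡⟨ eraseI-other-arity (substI⁺ σ φs) (substIs σ θs) (substI⁺ σ ψs)
           (subst (_≢ suc B) (sym (length-substI⁺ σ φs)) (<⇒≢ (s≤s length≤))) ⟩
    ind (erase⁺ (suc B) (substI⁺ σ φs)) (erasesI (suc B) (substIs σ θs))
        (erase⁺ (suc B) (substI⁺ σ ψs))
      ≡⟨ cong₂ (λ φs′ θs′ → ind φs′ θs′ _) (erase⁺-substI⁺ σ φs φs≤) (erasesI-substIs σ θs θs≤) ⟩
    ind (substI⁺ (eraseI (suc B) ∘ σ) φs) (substIs (eraseI (suc B) ∘ σ) θs)
        (erase⁺ (suc B) (substI⁺ σ ψs))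
      ≡⟨ cong (ind _ _) (erase⁺-substI⁺ σ ψs ψs≤) ⟩
    substI (eraseI (suc B) ∘ σ) (ind φs θs ψs) ∎
    where
    open ≡-Reasoning
    φsθs≤ : List⁺.length φs ⊔ arities⁺ φs ⊔ aritiesI θs ≤ B
    φsθs≤ = m⊔n≤o⇒m≤o _ (arities⁺ ψs) h
    φs′≤ : List⁺.length φs ⊔ arities⁺ φs ≤ B
    φs′≤ = m⊔n≤o⇒m≤o _ (aritiesI θs) φsθs≤
    length≤ : List⁺.length φs ≤ B
    length≤ = m⊔n≤o⇒m≤o _ (arities⁺ φs) φs′≤
    φs≤ : arities⁺ φs ≤ B
    φs≤ = m⊔n≤o⇒n≤o (List⁺.length φs) _ φs′≤
    θs≤ : aritiesI θs ≤ B
    θs≤ = m⊔n≤o⇒n≤o (List⁺.length φs ⊔ arities⁺ φs) _ φsθs≤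
    ψs≤ : arities⁺ ψs ≤ B
    ψs≤ = m⊔n≤o⇒n≤o (List⁺.length φs ⊔ arities⁺ φs ⊔ aritiesI θs) _ h

  erasesI-substIs : ∀ {B} σ φs → aritiesI φs ≤ B →
                    erasesI (suc B) (substIs σ φs) ≡ substIs (eraseI (suc B) ∘ σ) φs
  erasesI-substIs σ []       h = refl
  erasesI-substIs σ (φ ∷ φs) h =
    cong₂ _∷_ (eraseI-substI σ φ (m⊔n≤o⇒m≤o _ _ h)) (erasesI-substIs σ φs (m⊔n≤o⇒n≤o _ _ h))

  erase⁺-substI⁺ : ∀ {B} σ φs → arities⁺ φs ≤ B →
                   erase⁺ (suc B) (substI⁺ σ φs) ≡ substI⁺ (eraseI (suc B) ∘ σ) φs
  erase⁺-substI⁺ σ (φ ∷ φs) h =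
    cong₂ _∷_ (eraseI-substI σ φ (m⊔n≤o⇒m≤o _ _ h)) (erasesI-substIs σ φs (m⊔n≤o⇒n≤o _ _ h))

agreeI-refl : ∀ W u φs → agreeI W u u φs
agreeI-refl W u []       = tt
agreeI-refl W u (φ ∷ φs) = (id , id) , agreeI-refl W u φs

trivialInd : ℕ → FormI
trivialInd n = ind (atom 0 ∷ replicate n (atom 0)) (atom 0 ∷ []) (atom 0 ∷ [])

-- The witness is w₁ itself: it agrees with w₂ on p because the condition is p.
valid-trivialInd : ∀ n → ValidI (trivialInd n)
valid-trivialInd n W w _ w₁ w₂ w₁∈W _ same-p =
  w₁ , w₁∈W , agreeI-refl W w₁ _ , ((id , id) , agreeI-refl W w₁ _) , same-p

¬LI-FinitelyAxiomatizable : ¬ LI-FinitelyAxiomatizable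
¬LI-FinitelyAxiomatizable =
  Schematic.¬finitely-axiomatizable FormI substI ValidI arityI (eraseI ∘ suc)
    (λ {_} {χ} h σ → eraseI-substI σ χ h)
    (λ B → trivialInd B , valid-trivialInd B ,
      subst (¬_ ∘ ValidI)
        (sym (eraseI-arity (atom 0 ∷ replicate B (atom 0)) (atom 0 ∷ []) (atom 0 ∷ [])
               (cong suc (length-replicate B))))
        ¬valid-falsumI)

theorem7p7 : (∀ {ℓ} → ExcludedMiddle ℓ) →
    ¬ LD-FinitelyAxiomatizable × ¬ LI-FinitelyAxiomatizable
theorem7p7 _ = ¬LD-FinitelyAxiomatizable , ¬LI-FinitelyAxiomatizable
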